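{- Let $p$ be a prime, $R$ an $\mathbb{F}_p$-algebra and $\lambda\in R$. Then the group algebra scheme $A(G^{(\lambda)}_R)$ is $$A(G^{(\lambda)}_R)=\mathrm{Spec}\,R[T_{X^{r_1}Y^{r_2}}]_{0\le r_1,r_2\le p-1}$$ with the following structure. (a) The comultiplication of the coordinate ring is given as follows. If $r_1+r_2<p$, then $$T_{X^{r_1}Y^{r_2}}\mapsto \sum_{k=0}^{r_1}\sum_{k'=0}^{k}\sum_{l=0}^{r_2}\sum_{l'=0}^{l}\binom{k}{k'}\binom{r_1}{k}\binom{r_2}{l}\binom{l}{l'}\lambda^{k'+l'}\,T_{X^{r_1-k+k'+l'}Y^{r_2-l}}\otimes T_{X^kY^l}.$$ If $r_1+r_2\ge p$, then $$T_{X^{r_1}Y^{r_2}}\mapsto \sum_{k=0}^{r_1}\sum_{k'=0}^{k}\sum_{l=0}^{r_2}\sum_{l'=0}^{l}C(r_1,r_2,k,l,k',l')\,\lambda^{k'+l'}\,T_{X^{r_1-k+k'+l'}Y^{r_2-l}}\otimes T_{X^kY^l}.$$ Here $$C(r_1,r_2,k,l,k',l')=\begin{cases}0 & \text{if } r_1-k+k'+l'\ge p,\\ \binom{k}{k'}\binom{r_1}{k}\binom{r_2}{l}\binom{l}{l'} & \text{if } r_1-k+k'+l'<p.\end{cases}$$ (b) The counit is given by $T_1\mapsto 1$ and $T_{X^{r_1}Y^{r_2}}\mapsto 0$ whenever $r_1\neq0$ or $r_2\neq0$.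
   Context: Throughout, $p$ is a prime, $R$ is a commutative $\mathbb{F}_p$-algebra and $\lambda\in R$. The group scheme $\mathcal{H}^{(\lambda)}_R=\mathrm{Spec}\,R[X,Y,\frac{1}{1+\lambda X}]$ has: - comultiplication $X\mapsto X\otimes1+(1+\lambda X)\otimes X$ and $Y\mapsto Y\otimes1+(1+\lambda X)\otimes Y$; - counit $X,Y\mapsto0$; - antipode $X\mapsto -X/(1+\lambda X)$ and $Y\mapsto -Y/(1+\lambda X)$. The Frobenius $F:\mathcal H^{(\lambda)}_R\to\mathcal H^{(\lambda^p)}_R$ is given on coordinate rings by $X\mapsto X^p$, $Y\mapsto Y^p$. Its kernel is $G^{(\lambda)}_R=\mathrm{Spec}\,A^{(\lambda)}_R$, where $A^{(\lambda)}_R=R[X,Y]/(X^p,Y^p)$ carries the Hopf structure given by the same formulas. $A^{(\lambda)}_R$ is a free $R$-module with basis $\{X^{r_1}Y^{r_2}:0\le r_1,r_2\le p-1\}$. Group algebra scheme. Let $\Gamma=\mathrm{Spec}\,H$, where $H$ is an $R$-Hopf algebra that is free of finite rank with basis $e_1,\dots,e_n$. - $A(\Gamma)$ is the ring scheme $B\mapsto\mathrm{Hom}_R(H,B)$ on $R$-algebras $B$, with the convolution product. - It is represented by $\mathrm{Spec}\,R[T_{e_1},\dots,T_{e_n}]$, the symmetric algebra on $H$; a point $f$ corresponds to $T_{e_i}\mapsto f(e_i)$. - Write $\Delta_H(e_j)=\sum_i e_i\otimes R_{ij}(e_1,\dots,e_n)$ with $R_{ij}$ $R$-linear forms. The ring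 multiplication of $A(\Gamma)$ corresponds to the comultiplication $T_{e_j}\mapsto\sum_iT_{e_i}\otimes R_{ij}(T_{e_1},\dots,T_{e_n})$ of the coordinate ring. Equivalently, it is obtained from $\Delta_H(e_j)$ by replacing each basis element $e$ by $T_e$. - The unit corresponds to the counit $T_{e_j}\mapsto\varepsilon_H(e_j)$. For $\Gamma=G^{(\lambda)}_R$ with the basis $X^{r_1}Y^{r_2}$, the variable attached to $X^{r_1}Y^{r_2}$ is written $T_{X^{r_1}Y^{r_2}}$, and $T_1:=T_{X^0Y^0}$. -}

module Defs where

open import Level using (Level) renaming (suc to lsuc)
import Data.Nat as N
open N using (ℕ; zero; suc; _∸_; _≡ᵇ_; _<ᵇ_)
open import Data.Nat.Combinatorics using (_C_)
open import Data.Bool using (if_then_else_)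
open import Algebra.Bundles using (CommutativeRing)

-- Raw ring operations (no laws needed: we only compute with them).

record RawOps (a : Level) : Set (lsuc a) where
  field
    Carrier : Set a
    0# 1#   : Carrier
    _+_ _*_ : Carrier → Carrier → Carrier

module _ {a : Level} (S : RawOps a) where
  open RawOps S

  sumBelow : ℕ → (ℕ → Carrier) → Carrier
  sumBelow zero    f = 0#
  sumBelow (suc n) f = sumBelow n f + f n

  sumTo : ℕ → (ℕ → Carrier) → Carrier
  sumTo n f = sumBelow (suc n) f

  pow : Carrier → ℕ → Carrier
  pow x zero    = 1#
  pow x (suc n) = pow x n * x

  fromℕ : ℕ → Carrier
  fromℕ zero    = 0#
  fromℕ (suc n) = fromℕ n + 1#

  δ : ℕ → ℕ → Carrier
  δ m n = if m ≡ᵇ n then 1# else 0#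

-- Truncated polynomial ring S[Z]/(Z^p), elements given by their
-- coefficient functions f : ℕ → S (f n = coefficient of Z^n; only the
-- coefficients with n < p are meaningful, the others are ignored by the
-- multiplication and never read).

trunc : ∀ {a} → ℕ → RawOps a → RawOps a
trunc {a} p S = record
  { Carrier = ℕ → S.Carrier
  ; 0#      = λ _ → S.0#
  ; 1#      = λ n → if n ≡ᵇ 0 then S.1# else S.0#
  ; _+_     = λ f g n → f n S.+ g n
  ; _*_     = λ f g n → if n <ᵇ p
                          then sumTo S n (λ j → f j S.* g (n ∸ j))
                          else S.0#
  }
  where module S = RawOps S

module _ {a : Level} (p : ℕ) (S : RawOps a) where
  private module S = RawOps S
  ι : S.Carrier → RawOps.Carrier (trunc p S)
  ι s n = if n ≡ᵇ 0 then s else S.0#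
  Z : RawOps.Carrier (trunc p S)
  Z n = if n ≡ᵇ 1 then S.1# else S.0#

rawOf : ∀ {c ℓ} → CommutativeRing c ℓ → RawOps c
rawOf R = record { Carrier = Carrier ; 0# = 0# ; 1# = 1# ; _+_ = _+_ ; _*_ = _*_ }
  where open CommutativeRing R

-- R has characteristic p (i.e. is an F_p-algebra): p · 1 = 0 in R
CharP : ∀ {c ℓ} → CommutativeRing c ℓ → ℕ → Set ℓ
CharP R p = fromℕ (rawOf R) p ≈ 0#
  where open CommutativeRing R

module GroupAlg {c ℓ} (R : CommutativeRing c ℓ) (p : ℕ)
                (lam : CommutativeRing.Carrier R) where
  open CommutativeRing R using (Carrier)

  base : RawOps c
  base = rawOf R

  -- A = R[X,Y]/(X^p,Y^p): element f, f r₁ r₂ = coefficient of X^r₁ Y^r₂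
  T1 T2 T3 T4 : RawOps c
  T1 = trunc p base
  T2 = trunc p T1
  T3 = trunc p T2
  -- A ⊗_R A = R[X₁,Y₁,X₂,Y₂]/(X₁^p,Y₁^p,X₂^p,Y₂^p):
  -- element f, f a b c d = coefficient of X^a Y^b ⊗ X^c Y^d
  T4 = trunc p T3

  open RawOps T4 using (_+_; _*_; 1#)

  X₁ Y₁ X₂ Y₂ Λ : RawOps.Carrier T4
  X₁ = Z p T3
  Y₁ = ι p T3 (Z p T2)
  X₂ = ι p T3 (ι p T2 (Z p T1))
  Y₂ = ι p T3 (ι p T2 (ι p T1 (Z p base)))
  Λ  = ι p T3 (ι p T2 (ι p T1 (ι p base lam)))

  ΔX ΔY : RawOps.Carrier T4
  ΔX = X₁ + ((1# + (Λ * X₁)) * X₂)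
  ΔY = Y₁ + ((1# + (Λ * X₁)) * Y₂)

  -- Δ_A(X^r₁ Y^r₂) = Δ(X)^r₁ Δ(Y)^r₂  (Δ_A is an R-algebra homomorphism)
  ΔA : ℕ → ℕ → RawOps.Carrier T4
  ΔA r₁ r₂ = pow T4 ΔX r₁ * pow T4 ΔY r₂

  -- ε_A(X^r₁ Y^r₂) = 0^r₁ 0^r₂  (ε_A is the R-algebra map X, Y ↦ 0)
  εA : ℕ → ℕ → Carrier
  εA r₁ r₂ = RawOps._*_ base (pow base (RawOps.0# base) r₁) (pow base (RawOps.0# base) r₂)

  -- Comultiplication of the coordinate ring: T_{e_j} ↦ Σ_i T_{e_i} ⊗ R_ij(T),
  -- i.e. Δ_A(e_j) with every basis element e replaced by T_e.  The image of
  -- T_{X^r₁Y^r₂} is represented by its coefficient function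
  -- (a,b,c,d) ↦ coefficient of T_{X^a Y^b} ⊗ T_{X^c Y^d}.
  comultT : ℕ → ℕ → ℕ → ℕ → ℕ → ℕ → Carrier
  comultT r₁ r₂ a b c d = ΔA r₁ r₂ a b c d

  -- Counit of the coordinate ring: T_{e_j} ↦ ε_A(e_j).
  counitT : ℕ → ℕ → Carrier
  counitT r₁ r₂ = εA r₁ r₂

  private
    open RawOps base using () renaming (_*_ to _·_)
    n̂ : ℕ → Carrier
    n̂ = fromℕ base

  fourSum : (ℕ → ℕ → ℕ → ℕ → Carrier) → ℕ → ℕ → ℕ → ℕ → ℕ → ℕ → Carrier
  fourSum coef r₁ r₂ a b c d =
    sumTo base r₁ λ k → sumTo base k λ k' →
    sumTo base r₂ λ l → sumTo base l λ l' →
      ((coef k l k' l' · pow base lam (k' N.+ l'))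
        · ((δ base a (r₁ ∸ k N.+ k' N.+ l') · δ base b (r₂ ∸ l))
          · (δ base c k · δ base d l)))

  binoms : ℕ → ℕ → ℕ → ℕ → ℕ → ℕ → Carrier
  binoms r₁ r₂ k l k' l' = n̂ ((k C k') N.* (r₁ C k) N.* (r₂ C l) N.* (l C l'))

  Ccoef : ℕ → ℕ → ℕ → ℕ → ℕ → ℕ → Carrier
  Ccoef r₁ r₂ k l k' l' =
    if (r₁ ∸ k N.+ k' N.+ l') <ᵇ p then binoms r₁ r₂ k l k' l' else RawOps.0# base

  formulaSmall : ℕ → ℕ → ℕ → ℕ → ℕ → ℕ → Carrier
  formulaSmall r₁ r₂ = fourSum (binoms r₁ r₂) r₁ r₂

  formulaLarge : ℕ → ℕ → ℕ → ℕ → ℕ → ℕ → Carrier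
  formulaLarge r₁ r₂ = fourSum (Ccoef r₁ r₂) r₁ r₂

{-# OPTIONS --safe #-}
-- The coordinate ring of G × G, R[X₁,Y₁,X₂,Y₂]/(X₁ᵖ,Y₁ᵖ,X₂ᵖ,Y₂ᵖ), is the four-fold iterate of the
-- truncated polynomial semiring S ↦ S[Z]/(Zᵖ), and Δ(X^r₁ Y^r₂) = (X₁ + (1 + λX₁)X₂)^r₁ (Y₁ + (1 + λX₁)Y₂)^r₂.
-- Two binomial expansions per factor turn this into a sum of monomials
-- C λ^(k'+l') X₁^(r₁-k+k'+l') Y₁^(r₂-l) X₂^k Y₂^l, and the coefficient of such a monomial at exponents
-- below p is C times a product of Kronecker deltas. A monomial whose X₁-exponent reaches p has no
-- coefficient below p, so the truncated coefficients of formulaLarge give the same sum, for all r₁, r₂.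
module Submission where

open import Defs
open import Data.Nat as ℕ using (ℕ; zero; suc; _∸_; _≡ᵇ_; _<ᵇ_; _<_; _≤_; s≤s)
import Data.Nat.Properties as ℕ
open import Data.Fin using (Fin; toℕ)
open import Data.Nat.Combinatorics using (_C_)
open import Function using (_∘_)
open import Data.Bool using (true; false; if_then_else_; T)
open import Data.Unit using (tt)
open import Data.Empty using (⊥-elim)
open import Data.Sum using (_⊎_; inj₁; inj₂)
open import Level using (Level)
open import Relation.Binary.PropositionalEquality as ≡ using (_≡_; _≢_)
open import Algebra.Bundles using (CommutativeRing; CommutativeSemiring; Semiring)
import Relation.Binary.Reasoning.Setoid as SetoidReasoning
open import Relation.Binary.Structures using (IsEquivalence)
open import Algebra.Structures using (IsCommutativeMonoid)
open import Algebra.Morphism.Structures using (IsSemiringHomomorphism)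
import Algebra.Morphism.Construct.Identity as Identity
import Algebra.Morphism.Construct.Composition as Composition
open import Data.Vec using (Vec; []; _∷_)
open import Data.Vec.Relation.Unary.All using (All; []; _∷_)
open import Algebra.Structures.Biased using (isCommutativeMonoidˡ; isCommutativeSemiringˡ)

module FiniteSums {c ℓ} (S : CommutativeSemiring c ℓ) where
  open CommutativeSemiring S hiding (zero)
  open SetoidReasoning setoid
  open import Algebra.Properties.Semiring.Sum semiring using (sum)
  open import Algebra.Properties.Semiring.Exp semiring using (_^_)
  open import Algebra.Properties.Semiring.Mult semiring using (_×_)

  rawOps : RawOps c
  rawOps = record { Carrier = Carrier ; 0# = 0# ; 1# = 1# ; _+_ = _+_ ; _*_ = _*_ }

  ∑< : ℕ → (ℕ → Carrier) → Carrier
  ∑< = sumBelow rawOps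

  ∑<-cong : ∀ n {f g : ℕ → Carrier} → (∀ i → i < n → f i ≈ g i) → ∑< n f ≈ ∑< n g
  ∑<-cong zero    f≈g = refl
  ∑<-cong (suc n) f≈g = +-cong (∑<-cong n (λ i i<n → f≈g i (ℕ.m<n⇒m<1+n i<n))) (f≈g n ℕ.≤-refl)

  ∑<-zero : ∀ n {f : ℕ → Carrier} → (∀ i → i < n → f i ≈ 0#) → ∑< n f ≈ 0#
  ∑<-zero zero    f≈0 = refl
  ∑<-zero (suc n) f≈0 =
    trans (+-cong (∑<-zero n (λ i i<n → f≈0 i (ℕ.m<n⇒m<1+n i<n))) (f≈0 n ℕ.≤-refl)) (+-identityʳ 0#)

  ∑<-distrib-+ : ∀ n (f g : ℕ → Carrier) → ∑< n (λ i → f i + g i) ≈ ∑< n f + ∑< n g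
  ∑<-distrib-+ zero    f g = sym (+-identityˡ 0#)
  ∑<-distrib-+ (suc n) f g = begin
    ∑< n (λ i → f i + g i) + (f n + g n)  ≈⟨ +-congʳ (∑<-distrib-+ n f g) ⟩
    (∑< n f + ∑< n g) + (f n + g n)       ≈⟨ +-assoc _ _ _ ⟩
    ∑< n f + (∑< n g + (f n + g n))       ≈⟨ +-congˡ (x∙yz≈y∙xz _ _ _) ⟩
    ∑< n f + (f n + (∑< n g + g n))       ≈⟨ +-assoc _ _ _ ⟨
    ∑< (suc n) f + ∑< (suc n) g           ∎
    where open import Algebra.Properties.CommutativeSemigroup +-commutativeSemigroup using (x∙yz≈y∙xz)

  *-distribˡ-∑< : ∀ n x (f : ℕ → Carrier) → x * ∑< n f ≈ ∑< n (λ i → x * f i)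
  *-distribˡ-∑< zero    x f = zeroʳ x
  *-distribˡ-∑< (suc n) x f = trans (distribˡ x _ _) (+-congʳ (*-distribˡ-∑< n x f))

  *-distribʳ-∑< : ∀ n x (f : ℕ → Carrier) → ∑< n f * x ≈ ∑< n (λ i → f i * x)
  *-distribʳ-∑< zero    x f = zeroˡ x
  *-distribʳ-∑< (suc n) x f = trans (distribʳ x _ _) (+-congʳ (*-distribʳ-∑< n x f))

  ∑<-*-∑< : ∀ m n (f g : ℕ → Carrier) → ∑< m f * ∑< n g ≈ ∑< m (λ i → ∑< n (λ j → f i * g j))
  ∑<-*-∑< m n f g =
    trans (*-distribʳ-∑< m _ f) (∑<-cong m (λ i _ → *-distribˡ-∑< n (f i) g))

  ∑<-head : ∀ n (f : ℕ → Carrier) → ∑< (suc n) f ≈ f 0 + ∑< n (f ∘ suc)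
  ∑<-head zero    f = +-comm 0# (f 0)
  ∑<-head (suc n) f = trans (+-congʳ (∑<-head n f)) (+-assoc _ _ _)

  ∑≤-reverse : ∀ n (f : ℕ → Carrier) → ∑< (suc n) f ≈ ∑< (suc n) (λ j → f (n ∸ j))
  ∑≤-reverse zero    f = refl
  ∑≤-reverse (suc n) f = begin
    ∑< (suc n) f + f (suc n)                  ≈⟨ +-congʳ (∑≤-reverse n f) ⟩
    ∑< (suc n) (λ j → f (n ∸ j)) + f (suc n)  ≈⟨ +-comm _ _ ⟩
    f (suc n) + ∑< (suc n) (λ j → f (n ∸ j))  ≈⟨ ∑<-head (suc n) (λ j → f (suc n ∸ j)) ⟨
    ∑< (suc (suc n)) (λ j → f (suc n ∸ j))    ∎

  ∑≤-triangle : ∀ n (F : ℕ → ℕ → Carrier) →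
    ∑< (suc n) (λ j → ∑< (suc j) (λ i → F i (j ∸ i))) ≈ ∑< (suc n) (λ i → ∑< (suc (n ∸ i)) (F i))
  ∑≤-triangle zero    F = refl
  ∑≤-triangle (suc n) F = begin
    ∑< (suc n) (λ j → ∑< (suc j) (λ i → F i (j ∸ i))) + (diagonal + F (suc n) (n ∸ n))
      ≈⟨ +-cong (∑≤-triangle n F) (+-congˡ (reflexive (≡.cong (F (suc n)) (ℕ.n∸n≡0 n)))) ⟩
    ∑< (suc n) (λ i → ∑< (suc (n ∸ i)) (F i)) + (diagonal + F (suc n) 0)
      ≈⟨ +-assoc _ _ _ ⟨
    (∑< (suc n) (λ i → ∑< (suc (n ∸ i)) (F i)) + diagonal) + F (suc n) 0
      ≈⟨ +-cong (sym (∑<-distrib-+ (suc n) _ _)) (sym (+-identityˡ _)) ⟩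
    ∑< (suc n) (λ i → ∑< (suc (n ∸ i)) (F i) + F i (suc n ∸ i)) + ∑< 1 (F (suc n))
      ≈⟨ +-cong (∑<-cong (suc n) extend) (reflexive (≡.cong (λ m → ∑< (suc m) (F (suc n))) (≡.sym (ℕ.n∸n≡0 n)))) ⟩
    ∑< (suc n) (λ i → ∑< (suc (suc n ∸ i)) (F i)) + ∑< (suc (n ∸ n)) (F (suc n)) ∎
    where
    diagonal = ∑< (suc n) (λ i → F i (suc n ∸ i))
    extend : ∀ i → i < suc n → ∑< (suc (n ∸ i)) (F i) + F i (suc n ∸ i) ≈ ∑< (suc (suc n ∸ i)) (F i)
    extend i (s≤s i≤n) rewrite ℕ.+-∸-assoc 1 i≤n = refl

  ∑⁴ : ℕ → ℕ → (ℕ → ℕ → ℕ → ℕ → Carrier) → Carrier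
  ∑⁴ r₁ r₂ F = ∑< (suc r₁) λ k → ∑< (suc k) λ k' → ∑< (suc r₂) λ l → ∑< (suc l) λ l' → F k k' l l'

  ∑⁴-cong : ∀ r₁ r₂ {F G : ℕ → ℕ → ℕ → ℕ → Carrier} → (∀ k k' l l' → F k k' l l' ≈ G k k' l l') →
    ∑⁴ r₁ r₂ F ≈ ∑⁴ r₁ r₂ G
  ∑⁴-cong r₁ r₂ F≈G = ∑<-cong (suc r₁) λ k _ → ∑<-cong (suc k) λ k' _ →
    ∑<-cong (suc r₂) λ l _ → ∑<-cong (suc l) λ l' _ → F≈G k k' l l'

  ∑<-sum : ∀ n (f : ℕ → Carrier) → sum (λ (i : Fin n) → f (toℕ i)) ≈ ∑< n f
  ∑<-sum zero    f = refl
  ∑<-sum (suc n) f = trans (+-congˡ (∑<-sum n (f ∘ suc))) (sym (∑<-head n f))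

  fromℕ≈×1# : ∀ n → fromℕ rawOps n ≈ n × 1#
  fromℕ≈×1# zero    = refl
  fromℕ≈×1# (suc n) = trans (+-congʳ (fromℕ≈×1# n)) (+-comm _ _)

  pow≈^ : ∀ x n → pow rawOps x n ≈ x ^ n
  pow≈^ x zero    = refl
  pow≈^ x (suc n) = trans (*-congʳ (pow≈^ x n)) (*-comm _ _)

module Truncated {c ℓ} (p : ℕ) (S : CommutativeSemiring c ℓ) where
  open CommutativeSemiring S hiding (zero)
  open FiniteSums S
  open SetoidReasoning setoid

  Poly : Set c
  Poly = ℕ → Carrier

  infix 4 _≋_
  _≋_ : Poly → Poly → Set ℓ
  f ≋ g = ∀ n → n < p → f n ≈ g n

  open RawOps (trunc p rawOps) public
    using () renaming (_+_ to infixl 6 _⊕_; 0# to 0P; 1# to 1P)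

  infixl 7 _⊗_
  -- Opaque because unification at the fourth level of the iteration would otherwise unfold the
  -- nested convolutions; ΔA≡powers unfolds it once to meet the raw trunc operations defining ΔA.
  opaque
    _⊗_ : Poly → Poly → Poly
    _⊗_ = RawOps._*_ (trunc p rawOps)

    ⊗-coeff : ∀ f g {n} → n < p → (f ⊗ g) n ≡ ∑< (suc n) (λ j → f j * g (n ∸ j))
    ⊗-coeff f g {n} n<p with n <ᵇ p | ℕ.<⇒<ᵇ n<p
    ... | true | _ = ≡.refl

  private
    ∸-< : ∀ {n} j → n < p → n ∸ j < p
    ∸-< {n} j = ℕ.≤-<-trans (ℕ.m∸n≤m n j)

  ⊕-cong : ∀ {f f′ g g′} → f ≋ f′ → g ≋ g′ → f ⊕ g ≋ f′ ⊕ g′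
  ⊕-cong f≋f′ g≋g′ n n<p = +-cong (f≋f′ n n<p) (g≋g′ n n<p)

  ⊗-cong : ∀ {f f′ g g′} → f ≋ f′ → g ≋ g′ → f ⊗ g ≋ f′ ⊗ g′
  ⊗-cong {f} {f′} {g} {g′} f≋f′ g≋g′ n n<p = begin
    (f ⊗ g) n                             ≡⟨ ⊗-coeff f g n<p ⟩
    ∑< (suc n) (λ j → f j * g (n ∸ j))    ≈⟨ ∑<-cong (suc n) (λ j j≤n →
      *-cong (f≋f′ j (ℕ.≤-<-trans (ℕ.s≤s⁻¹ j≤n) n<p)) (g≋g′ (n ∸ j) (∸-< j n<p))) ⟩
    ∑< (suc n) (λ j → f′ j * g′ (n ∸ j))  ≡⟨ ⊗-coeff f′ g′ n<p ⟨
    (f′ ⊗ g′) n                           ∎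

  ⊗-comm : ∀ f g → f ⊗ g ≋ g ⊗ f
  ⊗-comm f g n n<p = begin
    (f ⊗ g) n                                       ≡⟨ ⊗-coeff f g n<p ⟩
    ∑< (suc n) (λ j → f j * g (n ∸ j))              ≈⟨ ∑≤-reverse n _ ⟩
    ∑< (suc n) (λ j → f (n ∸ j) * g (n ∸ (n ∸ j)))  ≈⟨ ∑<-cong (suc n) (λ j j≤n →
      trans (*-comm _ _) (*-congʳ (reflexive (≡.cong g (ℕ.m∸[m∸n]≡n (ℕ.s≤s⁻¹ j≤n)))))) ⟩
    ∑< (suc n) (λ j → g j * f (n ∸ j))              ≡⟨ ⊗-coeff g f n<p ⟨
    (g ⊗ f) n                                       ∎

  ⊗-identityˡ : ∀ f → 1P ⊗ f ≋ f
  ⊗-identityˡ f n n<p = begin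
    (1P ⊗ f) n                                  ≡⟨ ⊗-coeff 1P f n<p ⟩
    ∑< (suc n) (λ j → 1P j * f (n ∸ j))         ≈⟨ ∑<-head n _ ⟩
    1# * f n + ∑< n (λ j → 0# * f (n ∸ suc j))  ≈⟨ +-cong (*-identityˡ _) (∑<-zero n (λ _ _ → zeroˡ _)) ⟩
    f n + 0#                                    ≈⟨ +-identityʳ _ ⟩
    f n                                         ∎

  ⊗-zeroˡ : ∀ f → 0P ⊗ f ≋ 0P
  ⊗-zeroˡ f n n<p = begin
    (0P ⊗ f) n                           ≡⟨ ⊗-coeff 0P f n<p ⟩
    ∑< (suc n) (λ j → 0# * f (n ∸ j))    ≈⟨ ∑<-zero (suc n) (λ _ _ → zeroˡ _) ⟩
    0#                                   ∎

  ⊗-distribʳ : ∀ f g h → (g ⊕ h) ⊗ f ≋ (g ⊗ f) ⊕ (h ⊗ f)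
  ⊗-distribʳ f g h n n<p = begin
    ((g ⊕ h) ⊗ f) n                                           ≡⟨ ⊗-coeff (g ⊕ h) f n<p ⟩
    ∑< (suc n) (λ j → (g j + h j) * f (n ∸ j))                ≈⟨ ∑<-cong (suc n) (λ _ _ → distribʳ _ _ _) ⟩
    ∑< (suc n) (λ j → g j * f (n ∸ j) + h j * f (n ∸ j))      ≈⟨ ∑<-distrib-+ (suc n) _ _ ⟩
    ∑< (suc n) (λ j → g j * f (n ∸ j)) + ∑< (suc n) (λ j → h j * f (n ∸ j))
      ≡⟨ ≡.cong₂ _+_ (⊗-coeff g f n<p) (⊗-coeff h f n<p) ⟨
    ((g ⊗ f) ⊕ (h ⊗ f)) n                                     ∎

  ⊗-assoc : ∀ f g h → (f ⊗ g) ⊗ h ≋ f ⊗ (g ⊗ h)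
  ⊗-assoc f g h n n<p = begin
    ((f ⊗ g) ⊗ h) n
      ≡⟨ ⊗-coeff (f ⊗ g) h n<p ⟩
    ∑< (suc n) (λ j → (f ⊗ g) j * h (n ∸ j))
      ≈⟨ ∑<-cong (suc n) (λ j j≤n → begin
           (f ⊗ g) j * h (n ∸ j)
             ≡⟨ ≡.cong (_* h (n ∸ j)) (⊗-coeff f g (ℕ.≤-<-trans (ℕ.s≤s⁻¹ j≤n) n<p)) ⟩
           ∑< (suc j) (λ i → f i * g (j ∸ i)) * h (n ∸ j)
             ≈⟨ *-distribʳ-∑< (suc j) _ _ ⟩
           ∑< (suc j) (λ i → (f i * g (j ∸ i)) * h (n ∸ j))
             ≈⟨ ∑<-cong (suc j) (λ i i≤j → trans (*-assoc _ _ _)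
                  (*-congˡ (*-congˡ (reflexive (≡.cong h (≡.sym (∸-∸-cancel (ℕ.s≤s⁻¹ i≤j) (ℕ.s≤s⁻¹ j≤n)))))))) ⟩
           ∑< (suc j) (λ i → F i (j ∸ i)) ∎) ⟩
    ∑< (suc n) (λ j → ∑< (suc j) (λ i → F i (j ∸ i)))
      ≈⟨ ∑≤-triangle n F ⟩
    ∑< (suc n) (λ i → ∑< (suc (n ∸ i)) (F i))
      ≈⟨ ∑<-cong (suc n) (λ i _ → sym (*-distribˡ-∑< (suc (n ∸ i)) _ _)) ⟩
    ∑< (suc n) (λ i → f i * ∑< (suc (n ∸ i)) (λ m → g m * h (n ∸ i ∸ m)))
      ≈⟨ ∑<-cong (suc n) (λ i _ → *-congˡ (reflexive (≡.sym (⊗-coeff g h (∸-< i n<p))))) ⟩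
    ∑< (suc n) (λ i → f i * (g ⊗ h) (n ∸ i))
      ≡⟨ ⊗-coeff f (g ⊗ h) n<p ⟨
    (f ⊗ (g ⊗ h)) n ∎
    where
    F : ℕ → ℕ → Carrier
    F i m = f i * (g m * h (n ∸ i ∸ m))
    ∸-∸-cancel : ∀ {i j} → i ≤ j → j ≤ n → n ∸ i ∸ (j ∸ i) ≡ n ∸ j
    ∸-∸-cancel {i} {j} i≤j j≤n = ≡.trans (ℕ.∸-+-assoc n i (j ∸ i)) (≡.cong (n ∸_) (ℕ.m+[n∸m]≡n i≤j))

  ≋-isEquivalence : IsEquivalence _≋_
  ≋-isEquivalence = record
    { refl  = λ _ _ → refl
    ; sym   = λ f≋g n n<p → sym (f≋g n n<p)
    ; trans = λ f≋g g≋h n n<p → trans (f≋g n n<p) (g≋h n n<p)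
    }

  private
    isCommutativeMonoid : ∀ {_∙_} {ε} → (∀ {f f′ g g′} → f ≋ f′ → g ≋ g′ → f ∙ g ≋ f′ ∙ g′) →
      (∀ f g h → _∙_ (_∙_ f g) h ≋ _∙_ f (_∙_ g h)) → (∀ f → _∙_ ε f ≋ f) → (∀ f g → _∙_ f g ≋ _∙_ g f) →
      IsCommutativeMonoid _≋_ _∙_ ε
    isCommutativeMonoid ∙-cong assoc identityˡ comm = isCommutativeMonoidˡ record
      { isSemigroup = record
        { isMagma = record { isEquivalence = ≋-isEquivalence ; ∙-cong = ∙-cong }
        ; assoc   = assoc
        }
      ; identityˡ = identityˡ
      ; comm      = comm
      }

  commutativeSemiring : CommutativeSemiring c ℓ
  commutativeSemiring = record
    { Carrier = Poly ; _≈_ = _≋_ ; _+_ = _⊕_ ; _*_ = _⊗_ ; 0# = 0P ; 1# = 1P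
    ; isCommutativeSemiring = isCommutativeSemiringˡ record
      { +-isCommutativeMonoid = isCommutativeMonoid ⊕-cong
          (λ f g h n _ → +-assoc (f n) (g n) (h n)) (λ f n _ → +-identityˡ (f n)) (λ f g n _ → +-comm (f n) (g n))
      ; *-isCommutativeMonoid = isCommutativeMonoid ⊗-cong ⊗-assoc ⊗-identityˡ ⊗-comm
      ; distribʳ              = ⊗-distribʳ
      ; zeroˡ                 = ⊗-zeroˡ
      }
    }

  open import Algebra.Definitions.RawSemiring (CommutativeSemiring.rawSemiring commutativeSemiring)
    public using () renaming (_^_ to _^ᴾ_)

  constant : Carrier → Poly
  constant = ι p rawOps

  indeterminate : Poly
  indeterminate = Z p rawOps

  constant-⊗ : ∀ s f {n} → n < p → (constant s ⊗ f) n ≈ s * f n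
  constant-⊗ s f {n} n<p = begin
    (constant s ⊗ f) n                            ≡⟨ ⊗-coeff (constant s) f n<p ⟩
    ∑< (suc n) (λ j → constant s j * f (n ∸ j))   ≈⟨ ∑<-head n _ ⟩
    s * f n + ∑< n (λ j → 0# * f (n ∸ suc j))     ≈⟨ +-congˡ (∑<-zero n (λ _ _ → zeroˡ _)) ⟩
    s * f n + 0#                                  ≈⟨ +-identityʳ _ ⟩
    s * f n                                       ∎

  constant-isSemiringHomomorphism : IsSemiringHomomorphism rawSemiring
    (CommutativeSemiring.rawSemiring commutativeSemiring) constant
  constant-isSemiringHomomorphism = record
    { isNearSemiringHomomorphism = record
      { +-isMonoidHomomorphism = record
        { isMagmaHomomorphism = record
          { isRelHomomorphism = record { cong = constant-cong }
          ; homo              = constant-+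
          }
        ; ε-homo = λ { zero _ → refl ; (suc n) _ → refl }
        }
      ; *-homo = constant-*
      }
    ; 1#-homo = λ _ _ → refl
    }
    where
    constant-cong : ∀ {s t} → s ≈ t → constant s ≋ constant t
    constant-cong s≈t zero    _ = s≈t
    constant-cong s≈t (suc n) _ = refl

    constant-+ : ∀ s t → constant (s + t) ≋ constant s ⊕ constant t
    constant-+ s t zero    _ = refl
    constant-+ s t (suc n) _ = sym (+-identityˡ 0#)

    constant-* : ∀ s t → constant (s * t) ≋ constant s ⊗ constant t
    constant-* s t zero    0<p = sym (constant-⊗ s (constant t) 0<p)
    constant-* s t (suc n) n<p = sym (trans (constant-⊗ s (constant t) n<p) (zeroʳ s))

  indeterminate-⊗-zero : ∀ f → 0 < p → (indeterminate ⊗ f) 0 ≈ 0#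
  indeterminate-⊗-zero f 0<p = trans (reflexive (⊗-coeff indeterminate f 0<p)) (trans (+-identityˡ _) (zeroˡ _))

  indeterminate-⊗-suc : ∀ f {n} → suc n < p → (indeterminate ⊗ f) (suc n) ≈ f n
  indeterminate-⊗-suc f {n} n+1<p = begin
    (indeterminate ⊗ f) (suc n)
      ≡⟨ ⊗-coeff indeterminate f n+1<p ⟩
    ∑< (suc (suc n)) (λ j → indeterminate j * f (suc n ∸ j))
      ≈⟨ trans (∑<-head (suc n) _) (+-cong (zeroˡ _) (∑<-head n _)) ⟩
    0# + (1# * f n + ∑< n (λ j → 0# * f (n ∸ suc j)))
      ≈⟨ trans (+-identityˡ _) (+-cong (*-identityˡ _) (∑<-zero n (λ _ _ → zeroˡ _))) ⟩
    f n + 0#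
      ≈⟨ +-identityʳ _ ⟩
    f n ∎

  indeterminate^-⊗-constant : ∀ i g → indeterminate ^ᴾ i ⊗ constant g ≋ (λ n → if n ≡ᵇ i then g else 0#)
  indeterminate^-⊗-constant zero    g n n<p = ⊗-identityˡ (constant g) n n<p
  indeterminate^-⊗-constant (suc i) g n n<p =
    trans (⊗-assoc indeterminate (indeterminate ^ᴾ i) (constant g) n n<p) (shift n n<p)
    where
    shift : ∀ n → n < p → (indeterminate ⊗ (indeterminate ^ᴾ i ⊗ constant g)) n ≈ (if n ≡ᵇ suc i then g else 0#)
    shift zero    0<p   = indeterminate-⊗-zero (indeterminate ^ᴾ i ⊗ constant g) 0<p
    shift (suc n) n+1<p = trans (indeterminate-⊗-suc (indeterminate ^ᴾ i ⊗ constant g) n+1<p)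
      (indeterminate^-⊗-constant i g n (ℕ.<-trans (ℕ.n<1+n n) n+1<p))

  ∑<-coeff : ∀ m (F : ℕ → Poly) n → sumBelow (FiniteSums.rawOps commutativeSemiring) m F n ≡ ∑< m (λ k → F k n)
  ∑<-coeff zero    F n = ≡.refl
  ∑<-coeff (suc m) F n = ≡.cong (_+ F m n) (∑<-coeff m F n)

module HomomorphismProperties {c₁ ℓ₁ c₂ ℓ₂} (S : Semiring c₁ ℓ₁) (T : Semiring c₂ ℓ₂)
  {h : Semiring.Carrier S → Semiring.Carrier T}
  (h-isHom : IsSemiringHomomorphism (Semiring.rawSemiring S) (Semiring.rawSemiring T) h) where
  private
    module S = Semiring S
    module T = Semiring T
  open IsSemiringHomomorphism h-isHom
  open import Algebra.Properties.Semiring.Exp S using () renaming (_^_ to _^₁_)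
  open import Algebra.Properties.Semiring.Exp T using () renaming (_^_ to _^₂_)
  open import Algebra.Properties.Semiring.Mult S using () renaming (_×_ to _×₁_)
  open import Algebra.Properties.Semiring.Mult T using () renaming (_×_ to _×₂_)

  homo-^ : ∀ x n → h (x ^₁ n) T.≈ h x ^₂ n
  homo-^ x zero    = 1#-homo
  homo-^ x (suc n) = T.trans (*-homo x (x ^₁ n)) (T.*-congˡ (homo-^ x n))

  homo-× : ∀ n x → h (n ×₁ x) T.≈ n ×₂ h x
  homo-× zero    x = 0#-homo
  homo-× (suc n) x = T.trans (+-homo x (n ×₁ x)) (T.+-congˡ (homo-× n x))

  homo-^-* : ∀ x n y → h x ^₂ n T.* h y T.≈ h (x ^₁ n S.* y)
  homo-^-* x n y = T.sym (T.trans (*-homo (x ^₁ n) y) (T.*-congʳ (homo-^ x n)))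

module Tower {c ℓ} (p : ℕ) (S : CommutativeSemiring c ℓ) where
  open CommutativeSemiring S hiding (zero)
  open FiniteSums S using (rawOps; ∑<; ∑<-cong; ∑⁴)
  open SetoidReasoning setoid

  level : ℕ → CommutativeSemiring c ℓ
  level zero    = S
  level (suc n) = Truncated.commutativeSemiring p (level n)

  module AtLevel (n : ℕ) = Truncated p (level n)

  Elem : ℕ → Set c
  Elem n = CommutativeSemiring.Carrier (level n)

  lift : ∀ m {n} → Elem n → Elem (m ℕ.+ n)
  lift zero        x = x
  lift (suc m) {n} x = AtLevel.constant (m ℕ.+ n) (lift m x)

  lift-isSemiringHomomorphism : ∀ m {n} → IsSemiringHomomorphism
    (CommutativeSemiring.rawSemiring (level n)) (CommutativeSemiring.rawSemiring (level (m ℕ.+ n))) (lift m)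
  lift-isSemiringHomomorphism zero    {n} =
    Identity.isSemiringHomomorphism _ (CommutativeSemiring.refl (level n))
  lift-isSemiringHomomorphism (suc m) {n} =
    Composition.isSemiringHomomorphism (CommutativeSemiring.trans (level (suc m ℕ.+ n)))
      (lift-isSemiringHomomorphism m) (AtLevel.constant-isSemiringHomomorphism (m ℕ.+ n))

  module Lift m {n} = HomomorphismProperties (CommutativeSemiring.semiring (level n))
    (CommutativeSemiring.semiring (level (m ℕ.+ n))) (lift-isSemiringHomomorphism m)

  coefficient : ∀ {n} → Elem n → Vec ℕ n → Carrier
  coefficient x []       = x
  coefficient f (a ∷ as) = coefficient (f a) as

  coefficient-cong : ∀ {n} {f g : Elem n} {as : Vec ℕ n} → CommutativeSemiring._≈_ (level n) f g → All (_< p) as →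
    coefficient f as ≈ coefficient g as
  coefficient-cong f≈g []             = f≈g
  coefficient-cong f≈g (a<p ∷ as<p) = coefficient-cong (f≈g _ a<p) as<p

  coefficient-0# : ∀ {n} (as : Vec ℕ n) → coefficient (CommutativeSemiring.0# (level n)) as ≡ 0#
  coefficient-0# []       = ≡.refl
  coefficient-0# (a ∷ as) = coefficient-0# as

  coefficient-∑< : ∀ {n} m (F : ℕ → Elem n) (as : Vec ℕ n) →
    coefficient (sumBelow (FiniteSums.rawOps (level n)) m F) as ≡ ∑< m (λ k → coefficient (F k) as)
  coefficient-∑< m F []                = ≡.refl
  coefficient-∑< {suc n} m F (a ∷ as) =
    ≡.trans (≡.cong (λ x → coefficient x as) (AtLevel.∑<-coeff n m F a)) (coefficient-∑< m (λ k → F k a) as)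

  coefficient-∑⁴ : ∀ {n} r₁ r₂ (F : ℕ → ℕ → ℕ → ℕ → Elem n) (as : Vec ℕ n) →
    coefficient (FiniteSums.∑⁴ (level n) r₁ r₂ F) as ≈ ∑⁴ r₁ r₂ (λ k k' l l' → coefficient (F k k' l l') as)
  coefficient-∑⁴ r₁ r₂ F as =
    trans (reflexive (coefficient-∑< (suc r₁) _ as)) (∑<-cong (suc r₁) λ k _ →
    trans (reflexive (coefficient-∑< (suc k) _ as)) (∑<-cong (suc k) λ k' _ →
    trans (reflexive (coefficient-∑< (suc r₂) _ as)) (∑<-cong (suc r₂) λ l _ →
    reflexive (coefficient-∑< (suc l) _ as))))

  monomial : ∀ {n} → Carrier → Vec ℕ n → Elem n
  monomial         s []      = s
  monomial {suc n} s (i ∷ u) = indeterminate ^ᴾ i ⊗ constant (monomial s u)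
    where open AtLevel n

  kronecker : ∀ {n} → Vec ℕ n → Vec ℕ n → Carrier
  kronecker []       []      = 1#
  kronecker (a ∷ as) (i ∷ u) = δ rawOps a i * kronecker as u

  coefficient-monomial : ∀ {n} s (u as : Vec ℕ n) → All (_< p) as →
    coefficient (monomial s u) as ≈ s * kronecker as u
  coefficient-monomial s []      []       []           = sym (*-identityʳ s)
  coefficient-monomial {suc n} s (i ∷ u) (a ∷ as) (a<p ∷ as<p) = begin
    coefficient ((indeterminate ^ᴾ i ⊗ constant (monomial s u)) a) as
      ≈⟨ coefficient-cong (indeterminate^-⊗-constant i (monomial s u) a a<p) as<p ⟩
    coefficient (if a ≡ᵇ i then monomial s u else CommutativeSemiring.0# (level n)) as
      ≈⟨ select (a ≡ᵇ i) ⟩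
    s * (δ rawOps a i * kronecker as u) ∎
    where
    open AtLevel n
    select : ∀ b → coefficient (if b then monomial s u else CommutativeSemiring.0# (level n)) as ≈
                   s * ((if b then 1# else 0#) * kronecker as u)
    select true  = trans (coefficient-monomial s u as as<p) (*-congˡ (sym (*-identityˡ _)))
    select false = trans (reflexive (coefficient-0# as)) (sym (trans (*-congˡ (zeroˡ _)) (zeroʳ s)))

module Expansion {c ℓ} (S : CommutativeSemiring c ℓ) where
  open CommutativeSemiring S hiding (zero)
  open FiniteSums S
  open SetoidReasoning setoid
  open import Algebra.Properties.Semiring.Exp semiring using (_^_; ^-congˡ; ^-homo-*)
  open import Algebra.Properties.CommutativeSemiring.Exp S using (^-distrib-*)
  open import Algebra.Properties.Semiring.Mult semiring using (_×_; ×-congʳ; ×-assoc-*; ×1-homo-*)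
  open import Algebra.Solver.CommutativeMonoid *-commutativeMonoid using (solve; _⊜_; _⊕_)
  import Algebra.Properties.CommutativeSemiring.Binomial S as Binomial

  ×≈×1* : ∀ n x → n × x ≈ n × 1# * x
  ×≈×1* n x = sym (trans (×-assoc-* n 1# x) (×-congʳ n (*-identityˡ x)))

  binomial : ∀ n x y → (x + y) ^ n ≈ ∑< (suc n) (λ k → (n C k) × 1# * (x ^ k * y ^ (n ∸ k)))
  binomial n x y = begin
    (x + y) ^ n                                                   ≈⟨ Binomial.theorem n x y ⟩
    Binomial.binomialExpansion x y n                              ≈⟨ ∑<-sum (suc n) _ ⟩
    ∑< (suc n) (λ k → (n C k) × (x ^ k * y ^ (n ∸ k)))             ≈⟨ ∑<-cong (suc n) (λ k _ → ×≈×1* (n C k) _) ⟩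
    ∑< (suc n) (λ k → (n C k) × 1# * (x ^ k * y ^ (n ∸ k)))        ∎

  1#^ : ∀ n → 1# ^ n ≈ 1#
  1#^ zero    = refl
  1#^ (suc n) = trans (*-congˡ (1#^ n)) (*-identityˡ 1#)

  module _ (L x : Carrier) where

    binomial-1+ : ∀ k → (1# + L * x) ^ k ≈ ∑< (suc k) (λ k' → (k C k') × 1# * (L ^ k' * x ^ k'))
    binomial-1+ k = begin
      (1# + L * x) ^ k
        ≈⟨ trans (^-congˡ k (+-comm _ _)) (binomial k (L * x) 1#) ⟩
      ∑< (suc k) (λ k' → (k C k') × 1# * ((L * x) ^ k' * 1# ^ (k ∸ k')))
        ≈⟨ ∑<-cong (suc k) (λ k' _ → *-congˡ (trans (*-congˡ (1#^ (k ∸ k'))) (trans (*-identityʳ _) (^-distrib-* L x k')))) ⟩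
      ∑< (suc k) (λ k' → (k C k') × 1# * (L ^ k' * x ^ k')) ∎

    binomial-nested : ∀ r v w → (w + (1# + L * x) * v) ^ r ≈
      ∑< (suc r) λ k → ∑< (suc k) λ k' → ((k C k') ℕ.* (r C k)) × 1# * (L ^ k' * (x ^ k' * (v ^ k * w ^ (r ∸ k))))
    binomial-nested r v w = begin
      (w + (1# + L * x) * v) ^ r
        ≈⟨ trans (^-congˡ r (+-comm _ _)) (binomial r _ w) ⟩
      ∑< (suc r) (λ k → (r C k) × 1# * (((1# + L * x) * v) ^ k * w ^ (r ∸ k)))
        ≈⟨ ∑<-cong (suc r) (λ k _ → inner k) ⟩
      ∑< (suc r) (λ k → ∑< (suc k) λ k' → ((k C k') ℕ.* (r C k)) × 1# * (L ^ k' * (x ^ k' * (v ^ k * w ^ (r ∸ k))))) ∎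
      where
      inner : ∀ k → (r C k) × 1# * (((1# + L * x) * v) ^ k * w ^ (r ∸ k)) ≈
        ∑< (suc k) λ k' → ((k C k') ℕ.* (r C k)) × 1# * (L ^ k' * (x ^ k' * (v ^ k * w ^ (r ∸ k))))
      inner k = begin
        (r C k) × 1# * (((1# + L * x) * v) ^ k * w ^ (r ∸ k))
          ≈⟨ *-congˡ (trans (*-congʳ (^-distrib-* _ v k)) (*-assoc _ _ _)) ⟩
        (r C k) × 1# * ((1# + L * x) ^ k * (v ^ k * w ^ (r ∸ k)))
          ≈⟨ *-congˡ (*-congʳ (binomial-1+ k)) ⟩
        (r C k) × 1# * (∑< (suc k) (λ k' → (k C k') × 1# * (L ^ k' * x ^ k')) * (v ^ k * w ^ (r ∸ k)))
          ≈⟨ trans (*-congˡ (*-distribʳ-∑< (suc k) _ _)) (*-distribˡ-∑< (suc k) _ _) ⟩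
        ∑< (suc k) (λ k' → (r C k) × 1# * ((k C k') × 1# * (L ^ k' * x ^ k') * (v ^ k * w ^ (r ∸ k))))
          ≈⟨ ∑<-cong (suc k) (λ k' _ → trans (rearrange _ _ _ _ _) (*-congʳ (sym (×1-homo-* (k C k') (r C k))))) ⟩
        ∑< (suc k) (λ k' → ((k C k') ℕ.* (r C k)) × 1# * (L ^ k' * (x ^ k' * (v ^ k * w ^ (r ∸ k))))) ∎
        where
        rearrange : ∀ a b l y z → a * (b * (l * y) * z) ≈ b * a * (l * (y * z))
        rearrange = solve 5 (λ a b l y z → a ⊕ ((b ⊕ (l ⊕ y)) ⊕ z) ⊜ (b ⊕ a) ⊕ (l ⊕ (y ⊕ z))) refl

  binomialProduct : ℕ → ℕ → ℕ → ℕ → ℕ → ℕ → ℕ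
  binomialProduct r₁ r₂ k l k' l' = (((k C k') ℕ.* (r₁ C k)) ℕ.* (r₂ C l)) ℕ.* (l C l')

  expansion : ∀ L x₁ y₁ x₂ y₂ r₁ r₂ →
    (x₁ + (1# + L * x₁) * x₂) ^ r₁ * (y₁ + (1# + L * x₁) * y₂) ^ r₂ ≈
    (∑⁴ r₁ r₂ λ k k' l l' → x₁ ^ (r₁ ∸ k ℕ.+ k' ℕ.+ l') * (y₁ ^ (r₂ ∸ l) * (x₂ ^ k * (y₂ ^ l *
        (binomialProduct r₁ r₂ k l k' l' × 1# * L ^ (k' ℕ.+ l'))))))
  expansion L x₁ y₁ x₂ y₂ r₁ r₂ = begin
    (x₁ + (1# + L * x₁) * x₂) ^ r₁ * (y₁ + (1# + L * x₁) * y₂) ^ r₂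
      ≈⟨ *-cong (binomial-nested L x₁ r₁ x₂ x₁) (binomial-nested L x₁ r₂ y₂ y₁) ⟩
    ∑< (suc r₁) (λ k → ∑< (suc k) (A k)) * ∑< (suc r₂) (λ l → ∑< (suc l) (B l))
      ≈⟨ *-distribʳ-∑< (suc r₁) _ _ ⟩
    ∑< (suc r₁) (λ k → ∑< (suc k) (A k) * ∑< (suc r₂) (λ l → ∑< (suc l) (B l)))
      ≈⟨ ∑<-cong (suc r₁) (λ k _ → trans (∑<-*-∑< (suc k) (suc r₂) _ _)
           (∑<-cong (suc k) (λ k' _ → ∑<-cong (suc r₂) (λ l _ → trans (*-distribˡ-∑< (suc l) _ _)
             (∑<-cong (suc l) (λ l' _ → product k k' l l'))))))  ⟩
    (∑⁴ r₁ r₂ λ k k' l l' → x₁ ^ (r₁ ∸ k ℕ.+ k' ℕ.+ l') * (y₁ ^ (r₂ ∸ l) * (x₂ ^ k * (y₂ ^ l *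
        (binomialProduct r₁ r₂ k l k' l' × 1# * L ^ (k' ℕ.+ l')))))) ∎
    where
    A : ℕ → ℕ → Carrier
    A k k' = ((k C k') ℕ.* (r₁ C k)) × 1# * (L ^ k' * (x₁ ^ k' * (x₂ ^ k * x₁ ^ (r₁ ∸ k))))
    B : ℕ → ℕ → Carrier
    B l l' = ((l C l') ℕ.* (r₂ C l)) × 1# * (L ^ l' * (x₁ ^ l' * (y₂ ^ l * y₁ ^ (r₂ ∸ l))))

    coefficients : ∀ a b c d → (a ℕ.* b) ℕ.* (d ℕ.* c) ≡ ((a ℕ.* b) ℕ.* c) ℕ.* d
    coefficients a b c d = ≡.trans (≡.cong ((a ℕ.* b) ℕ.*_) (ℕ.*-comm d c)) (≡.sym (ℕ.*-assoc (a ℕ.* b) c d))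

    product : ∀ k k' l l' → A k k' * B l l' ≈
      x₁ ^ (r₁ ∸ k ℕ.+ k' ℕ.+ l') * (y₁ ^ (r₂ ∸ l) * (x₂ ^ k * (y₂ ^ l *
        (binomialProduct r₁ r₂ k l k' l' × 1# * L ^ (k' ℕ.+ l')))))
    product k k' l l' = begin
      A k k' * B l l'
        ≈⟨ rearrange _ _ _ _ _ _ _ _ _ _ ⟩
      (x₁ ^ (r₁ ∸ k) * x₁ ^ k' * x₁ ^ l') * (y₁ ^ (r₂ ∸ l) * (x₂ ^ k * (y₂ ^ l *
        (((k C k') ℕ.* (r₁ C k)) × 1# * (((l C l') ℕ.* (r₂ C l)) × 1#) * (L ^ k' * L ^ l')))))
        ≈⟨ *-cong (sym (trans (^-homo-* x₁ (r₁ ∸ k ℕ.+ k') l') (*-congʳ (^-homo-* x₁ (r₁ ∸ k) k'))))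
             (*-congˡ (*-congˡ (*-congˡ (*-cong
               (trans (sym (×1-homo-* ((k C k') ℕ.* (r₁ C k)) ((l C l') ℕ.* (r₂ C l))))
                 (reflexive (≡.cong (_× 1#) (coefficients (k C k') (r₁ C k) (r₂ C l) (l C l')))))
               (sym (^-homo-* L k' l')))))) ⟩
      x₁ ^ (r₁ ∸ k ℕ.+ k' ℕ.+ l') * (y₁ ^ (r₂ ∸ l) * (x₂ ^ k * (y₂ ^ l *
        (binomialProduct r₁ r₂ k l k' l' × 1# * L ^ (k' ℕ.+ l'))))) ∎
      where
      rearrange : ∀ cA Lk xk x₂k xr cB Ll xl y₂l yr →
        cA * (Lk * (xk * (x₂k * xr))) * (cB * (Ll * (xl * (y₂l * yr)))) ≈
        (xr * xk * xl) * (yr * (x₂k * (y₂l * (cA * cB * (Lk * Ll)))))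
      rearrange = solve 10 (λ cA Lk xk x₂k xr cB Ll xl y₂l yr →
        (cA ⊕ (Lk ⊕ (xk ⊕ (x₂k ⊕ xr)))) ⊕ (cB ⊕ (Ll ⊕ (xl ⊕ (y₂l ⊕ yr)))) ⊜
        ((xr ⊕ xk) ⊕ xl) ⊕ (yr ⊕ (x₂k ⊕ (y₂l ⊕ ((cA ⊕ cB) ⊕ (Lk ⊕ Ll)))))) refl

module CoordinateRing {c ℓ} (R : CommutativeRing c ℓ) (p : ℕ) (lam : CommutativeRing.Carrier R) where
  open GroupAlg R p lam
  private
    S : CommutativeSemiring c ℓ
    S = CommutativeRing.commutativeSemiring R
  open CommutativeSemiring S hiding (zero)
  open FiniteSums S using (rawOps; ∑⁴-cong; fromℕ≈×1#; pow≈^)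
  open Tower p S
  module S₄ = CommutativeSemiring (level 4)
  open import Algebra.Properties.Semiring.Exp S₄.semiring using () renaming (_^_ to _^₄_)
  open import Algebra.Properties.Semiring.Mult S₄.semiring using () renaming (_×_ to _×₄_; ×-congʳ to ×₄-congʳ)
  open Expansion (level 4) using (expansion; binomialProduct)


  powers≈monomial : ∀ s a b e f → X₁ ^₄ a S₄.* (Y₁ ^₄ b S₄.* (X₂ ^₄ e S₄.* (Y₂ ^₄ f S₄.* lift 4 {0} s)))
    S₄.≈ monomial s (a ∷ b ∷ e ∷ f ∷ [])
  powers≈monomial s a b e f = S₄.trans (S₄.*-congˡ (S₄.*-congˡ (S₄.*-congˡ absorb-Y₂)))
    (S₄.trans (S₄.*-congˡ (S₄.*-congˡ absorb-X₂)) (S₄.*-congˡ absorb-Y₁))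
    where
    absorb-Y₂ : Y₂ ^₄ f S₄.* lift 4 {0} s S₄.≈ lift 3 {1} (monomial s (f ∷ []))
    absorb-Y₂ = Lift.homo-^-* 3 {1} (AtLevel.indeterminate 0) f (AtLevel.constant 0 s)
    absorb-X₂ : X₂ ^₄ e S₄.* lift 3 {1} (monomial s (f ∷ [])) S₄.≈ lift 2 {2} (monomial s (e ∷ f ∷ []))
    absorb-X₂ = Lift.homo-^-* 2 {2} (AtLevel.indeterminate 1) e (AtLevel.constant 1 (monomial s (f ∷ [])))
    absorb-Y₁ : Y₁ ^₄ b S₄.* lift 2 {2} (monomial s (e ∷ f ∷ [])) S₄.≈ lift 1 {3} (monomial s (b ∷ e ∷ f ∷ []))
    absorb-Y₁ = Lift.homo-^-* 1 {3} (AtLevel.indeterminate 2) b (AtLevel.constant 2 (monomial s (e ∷ f ∷ [])))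

  lift-fromℕ*pow : ∀ m e → m ×₄ S₄.1# S₄.* Λ ^₄ e S₄.≈ lift 4 {0} (fromℕ rawOps m * pow rawOps lam e)
  lift-fromℕ*pow m e = S₄.sym (S₄.trans (*-homo (fromℕ rawOps m) (pow rawOps lam e)) (S₄.*-cong
    (S₄.trans (⟦⟧-cong (fromℕ≈×1# m)) (S₄.trans (homo-× m 1#) (×₄-congʳ m 1#-homo)))
    (S₄.trans (⟦⟧-cong (pow≈^ lam e)) (homo-^ lam e))))
    where
    open Lift 4 {0}
    open IsSemiringHomomorphism (lift-isSemiringHomomorphism 4 {0})

  ΔX′ ΔY′ : Elem 4
  ΔX′ = X₁ S₄.+ (S₄.1# S₄.+ Λ S₄.* X₁) S₄.* X₂
  ΔY′ = Y₁ S₄.+ (S₄.1# S₄.+ Λ S₄.* X₁) S₄.* Y₂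

  opaque
    unfolding Truncated._⊗_
    ΔA≡powers : ∀ r₁ r₂ → ΔA r₁ r₂ ≡ pow (FiniteSums.rawOps (level 4)) ΔX′ r₁ S₄.* pow (FiniteSums.rawOps (level 4)) ΔY′ r₂
    ΔA≡powers r₁ r₂ = ≡.refl

  ΔA≈powers : ∀ r₁ r₂ → ΔA r₁ r₂ S₄.≈ ΔX′ ^₄ r₁ S₄.* ΔY′ ^₄ r₂
  ΔA≈powers r₁ r₂ = S₄.trans (S₄.reflexive (ΔA≡powers r₁ r₂))
    (S₄.*-cong (FiniteSums.pow≈^ (level 4) ΔX′ r₁) (FiniteSums.pow≈^ (level 4) ΔY′ r₂))

  ΔA-monomials : ∀ r₁ r₂ → ΔA r₁ r₂ S₄.≈ FiniteSums.∑⁴ (level 4) r₁ r₂ (λ k k' l l' →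
    monomial (binoms r₁ r₂ k l k' l' * pow rawOps lam (k' ℕ.+ l')) (r₁ ∸ k ℕ.+ k' ℕ.+ l' ∷ r₂ ∸ l ∷ k ∷ l ∷ []))
  ΔA-monomials r₁ r₂ = S₄.trans (ΔA≈powers r₁ r₂) (S₄.trans (expansion Λ X₁ Y₁ X₂ Y₂ r₁ r₂)
    (FiniteSums.∑⁴-cong (level 4) r₁ r₂ term≈monomial))
    where
    term≈monomial : ∀ k k' l l' →
      X₁ ^₄ (r₁ ∸ k ℕ.+ k' ℕ.+ l') S₄.* (Y₁ ^₄ (r₂ ∸ l) S₄.* (X₂ ^₄ k S₄.* (Y₂ ^₄ l S₄.*
        (binomialProduct r₁ r₂ k l k' l' ×₄ S₄.1# S₄.* Λ ^₄ (k' ℕ.+ l')))))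
      S₄.≈ monomial (binoms r₁ r₂ k l k' l' * pow rawOps lam (k' ℕ.+ l')) (r₁ ∸ k ℕ.+ k' ℕ.+ l' ∷ r₂ ∸ l ∷ k ∷ l ∷ [])
    term≈monomial k k' l l' =
      S₄.trans (S₄.*-congˡ (S₄.*-congˡ (S₄.*-congˡ (S₄.*-congˡ
        (lift-fromℕ*pow (binomialProduct r₁ r₂ k l k' l') (k' ℕ.+ l'))))))
        (powers≈monomial (binoms r₁ r₂ k l k' l' * pow rawOps lam (k' ℕ.+ l'))
          (r₁ ∸ k ℕ.+ k' ℕ.+ l') (r₂ ∸ l) k l)

  comultT≈formulaSmall : ∀ r₁ r₂ a b e f → a < p → b < p → e < p → f < p →
    comultT r₁ r₂ a b e f ≈ formulaSmall r₁ r₂ a b e f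
  comultT≈formulaSmall r₁ r₂ a b e f a<p b<p e<p f<p = trans
    (coefficient-cong {4} {ΔA r₁ r₂} (ΔA-monomials r₁ r₂) bounds)
    (trans (coefficient-∑⁴ r₁ r₂ term indices) (∑⁴-cong r₁ r₂ λ k k' l l' →
      trans (coefficient-monomial (scalar k k' l l') (exponents k k' l l') indices bounds)
        (*-congˡ (regroup _ _ _ _))))
    where
    indices : Vec ℕ 4
    indices = a ∷ b ∷ e ∷ f ∷ []
    bounds : All (_< p) indices
    bounds = a<p ∷ b<p ∷ e<p ∷ f<p ∷ []
    scalar : ℕ → ℕ → ℕ → ℕ → Carrier
    scalar k k' l l' = binoms r₁ r₂ k l k' l' * pow rawOps lam (k' ℕ.+ l')
    exponents : ℕ → ℕ → ℕ → ℕ → Vec ℕ 4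
    exponents k k' l l' = r₁ ∸ k ℕ.+ k' ℕ.+ l' ∷ r₂ ∸ l ∷ k ∷ l ∷ []
    term : ℕ → ℕ → ℕ → ℕ → Elem 4
    term k k' l l' = monomial (scalar k k' l l') (exponents k k' l l')
    regroup : ∀ w x y z → w * (x * (y * (z * 1#))) ≈ (w * x) * (y * z)
    regroup w x y z = trans (*-congˡ (*-congˡ (*-congˡ (*-identityʳ z)))) (sym (*-assoc w x (y * z)))

  δ-beyond : ∀ {a} E → a < p → (E <ᵇ p) ≡ false → δ rawOps a E ≡ 0#
  δ-beyond {a} E a<p E≮ᵇp with a ≡ᵇ E in a≡ᵇE
  ... | false = ≡.refl
  ... | true  = ⊥-elim (≡.subst T E≮ᵇp (ℕ.<⇒<ᵇ (≡.subst (_< p) a≡E a<p)))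
    where
    a≡E : a ≡ E
    a≡E = ℕ.≡ᵇ⇒≡ a E (≡.subst T (≡.sym a≡ᵇE) tt)

  formulaSmall≈formulaLarge : ∀ r₁ r₂ a b e f → a < p → formulaSmall r₁ r₂ a b e f ≈ formulaLarge r₁ r₂ a b e f
  formulaSmall≈formulaLarge r₁ r₂ a b e f a<p = ∑⁴-cong r₁ r₂ λ k k' l l' →
    truncation (r₁ ∸ k ℕ.+ k' ℕ.+ l') (binoms r₁ r₂ k l k' l') _ _ _
    where
    truncation : ∀ E s w x y → (s * w) * ((δ rawOps a E * x) * y) ≈
                                ((if E <ᵇ p then s else 0#) * w) * ((δ rawOps a E * x) * y)
    truncation E s w x y with E <ᵇ p in E<ᵇp
    ... | true  = refl
    ... | false = trans (vanishes s) (sym (vanishes 0#))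
      where
      vanishes : ∀ t → (t * w) * ((δ rawOps a E * x) * y) ≈ 0#
      vanishes t = trans (*-congˡ (trans (*-congʳ (trans (*-congʳ (reflexive (δ-beyond E a<p E<ᵇp)))
        (zeroˡ x))) (zeroˡ y))) (zeroʳ _)

  pow-0# : ∀ {n} → n ≢ 0 → pow rawOps 0# n ≈ 0#
  pow-0# {zero}  n≢0 = ⊥-elim (n≢0 ≡.refl)
  pow-0# {suc n} _   = zeroʳ _

  counitT-nonzero : ∀ r₁ r₂ → r₁ ≢ 0 ⊎ r₂ ≢ 0 → counitT r₁ r₂ ≈ 0#
  counitT-nonzero r₁ r₂ (inj₁ r₁≢0) = trans (*-congʳ (pow-0# r₁≢0)) (zeroˡ _)
  counitT-nonzero r₁ r₂ (inj₂ r₂≢0) = trans (*-congˡ (pow-0# r₂≢0)) (zeroʳ _)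

open import Data.Nat using (_+_)
open import Data.Nat.Primality using (Prime)
open import Data.Product using (_×_; _,_)

proposition3p1 : ∀ {c ℓ : Level} (R : CommutativeRing c ℓ) (p : ℕ) → Prime p →
    CharP R p → (lam : CommutativeRing.Carrier R) →
    let open GroupAlg R p lam
        _≈_ = CommutativeRing._≈_ R
    in ((r₁ r₂ a b e f : ℕ) → r₁ < p → r₂ < p → a < p → b < p → e < p → f < p →
          (r₁ + r₂ < p → comultT r₁ r₂ a b e f ≈ formulaSmall r₁ r₂ a b e f)
          × (p ≤ r₁ + r₂ → comultT r₁ r₂ a b e f ≈ formulaLarge r₁ r₂ a b e f))
       × (counitT 0 0 ≈ CommutativeRing.1# R)
       × ((r₁ r₂ : ℕ) → r₁ < p → r₂ < p → (r₁ ≢ 0 ⊎ r₂ ≢ 0) → counitT r₁ r₂ ≈ CommutativeRing.0# R)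
proposition3p1 R p _ _ lam =
    (λ r₁ r₂ a b e f _ _ a<p b<p e<p f<p →
      (λ _ → small r₁ r₂ a b e f a<p b<p e<p f<p)
    , (λ _ → R.trans (small r₁ r₂ a b e f a<p b<p e<p f<p) (formulaSmall≈formulaLarge r₁ r₂ a b e f a<p)))
  , R.*-identityˡ R.1#
  , λ r₁ r₂ _ _ → counitT-nonzero r₁ r₂
  where
  module R = CommutativeRing R
  open CoordinateRing R p lam renaming (comultT≈formulaSmall to small)
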